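{- Let $m$ and $k$ be positive integers, and suppose there exists a positive integer that is a $k$th power non-residue modulo $m$; let $n=n_k(m)$ be the least such positive integer. Let $R=R_k(m)$ be the greatest number of consecutive integers $a+1,a+2,\ldots,a+R$ ($a\in\mathbb Z$) that are all $k$th power residues modulo $m$. Then $R<m/n$. Consequently, if $m$ is a prime, then $n<\sqrt m+1/2$. Moreover: let $p$ be an odd prime and $k$ a positive integer with $\gcd(k,p-1)>1$. If $-1$ is a $k$th power residue modulo $p$ (equivalently, $(p-1)/\gcd(k,p-1)$ is even) and $n_k(p)\neq 2$, where $n_k(p)$ is the least positive $k$th power non-residue modulo $p$, then $n_k(p)<\sqrt{p/2}+1/4$.
   Context: For a positive integer $m$ and an integer $a$ with $\gcd(a,m)=1$: $a$ is called a $k$th power residue modulo $m$ if the congruence $x^k\equiv a \pmod m$ has an integer solution $x$, and a $k$th power non-residue modulo $m$ otherwise. Integers not coprime to $m$ are neither $k$th power residues nor $k$th power non-residues. -}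

module Defs where

open import Data.Nat as ℕ using (ℕ; _≤_; _<_)
open import Data.Nat.Coprimality using (Coprime)
open import Data.Integer as ℤ using (ℤ; +_; ∣_∣)
open import Data.Integer.Divisibility using (_∣_)
open import Data.Product using (Σ; ∃; _×_)
open import Relation.Nullary using (¬_)

IsPowerResidue : ℕ → ℕ → ℤ → Set
IsPowerResidue k m a = Coprime ∣ a ∣ m × ∃ λ (x : ℤ) → (+ m) ∣ (x ℤ.^ k ℤ.- a)

IsPowerNonResidue : ℕ → ℕ → ℤ → Set
IsPowerNonResidue k m a = Coprime ∣ a ∣ m × ¬ (∃ λ (x : ℤ) → (+ m) ∣ (x ℤ.^ k ℤ.- a))

IsLeastNonResidue : ℕ → ℕ → ℕ → Set
IsLeastNonResidue k m n =
  1 ≤ n × IsPowerNonResidue k m (+ n) ×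
  (∀ j → 1 ≤ j → j < n → ¬ IsPowerNonResidue k m (+ j))

IsResidueRun : ℕ → ℕ → ℤ → ℕ → Set
IsResidueRun k m a R = ∀ i → 1 ≤ i → i ≤ R → IsPowerResidue k m (a ℤ.+ + i)

IsGreatestResidueRun : ℕ → ℕ → ℕ → Set
IsGreatestResidueRun k m R =
  (∃ λ (a : ℤ) → IsResidueRun k m a R) ×
  (∀ (a : ℤ) (R′ : ℕ) → IsResidueRun k m a R′ → R′ ≤ R)

{-# OPTIONS --safe #-}
module Submission where

-- Suppose m ≤ R n for a run a+1, …, a+R of residues. The multiples n(a+1), …, n(a+R) advance
-- in steps of n across at least m consecutive integers, so one of them, n y, is congruent mod m
-- to some j with 0 ≤ j < n. By minimality j is a residue, and so is y, hence n ≡ j y⁻¹ is one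
-- too: a contradiction. For prime m the numbers 1, …, n − 1 form such a run, so (n − 1) n < m.
--
-- If moreover −1 is a residue and n > 2, write p = q n + r with 0 < r < n. Then n q ≡ −r and
-- n (q + 1) ≡ n − r are residues. Whichever of q, q + 1 is even, say 2t, satisfies t ≥ n, since
-- otherwise 2 and t are residues and so is n = (n · 2t) / (2 · t). Hence q ≥ 2n − 1 and
-- p ≥ (2n − 1) n + 1.

open import Defs
open import Data.Nat using (ℕ)

module ModularArithmetic where

  open import Data.Nat as ℕ using (zero; suc; _∸_; s≤s; NonZero)
  import Data.Nat.Properties as ℕ
  import Data.Nat.Divisibility as ℕ
  import Data.Nat.DivMod as ℕ
  open import Data.Nat.Coprimality using (Coprime; coprime-Bézout; coprime-divisor)
  open import Data.Nat.GCD using (module Bézout)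
  open import Data.Integer using (ℤ; +_; -[1+_]; ∣_∣; _+_; _-_; -_; _*_; _^_; 0ℤ; 1ℤ)
  open import Data.Integer.Properties
    using (abs-*; pos-*; neg-distribˡ-*; +-identityʳ; ∣i-j∣≡∣j-i∣; ⊖-≥; m-n≡m⊖n)
  open import Data.Integer.Divisibility using (_∣_)
  open import Data.Integer.Divisibility.Signed as Signed using (divides; ∣ᵤ⇒∣; ∣⇒∣ᵤ)
  open import Data.Integer.DivMod using (_%ℕ_; _/ℕ_; a≡a%ℕn+[a/ℕn]*n; n%ℕd<d)
  open import Data.Integer.Tactic.RingSolver using (solve-∀)
  open import Data.Product using (∃₂; ∃-syntax; _×_; _,_)
  open import Data.Sum using (_⊎_; inj₁; inj₂)
  open import Function using (_∘_)
  open import Level using (0ℓ)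
  open import Relation.Binary.Bundles using (Setoid)
  open import Relation.Binary.Structures using (IsEquivalence)
  open import Relation.Binary.PropositionalEquality
    using (_≡_; refl; sym; trans; cong; subst; module ≡-Reasoning)
  open import Relation.Nullary using (Dec)
  import Relation.Nullary.Decidable as Dec

  private variable
    a b c d : ℤ
    i j m : ℕ

  pos-∸ : j ℕ.≤ i → + (i ∸ j) ≡ + i - + j
  pos-∸ {j} {i} j≤i = trans (sym (⊖-≥ j≤i)) (sym (m-n≡m⊖n i j))

  i*i^[k∸1]≡i^k : ∀ k .{{_ : NonZero k}} a → a * a ^ (k ∸ 1) ≡ a ^ k
  i*i^[k∸1]≡i^k (suc k) a = refl

  ^-distrib-* : ∀ a b k → (a * b) ^ k ≡ a ^ k * b ^ k
  ^-distrib-* a b zero    = refl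
  ^-distrib-* a b (suc k) = trans (cong (a * b *_) (^-distrib-* a b k)) (interchange a b (a ^ k) (b ^ k))
    where
    interchange : ∀ a b c d → a * b * (c * d) ≡ a * c * (b * d)
    interchange = solve-∀

  even-or-odd : ∀ q → ∃[ t ] (t ℕ.* 2 ≡ q ⊎ t ℕ.* 2 ≡ suc q)
  even-or-odd zero          = 0 , inj₁ refl
  even-or-odd (suc zero)    = 1 , inj₂ refl
  even-or-odd (suc (suc q)) with even-or-odd q
  ... | t , inj₁ t*2≡q   = suc t , inj₁ (cong (λ x → suc (suc x)) t*2≡q)
  ... | t , inj₂ t*2≡q+1 = suc t , inj₂ (cong (λ x → suc (suc x)) t*2≡q+1)

  -- A record rather than a function, so that a, b and m can be inferred from a proof.
  infix 4 _≡_mod_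
  record _≡_mod_ (a b : ℤ) (m : ℕ) : Set where
    constructor mk≡mod
    field
      m∣a-b : + m ∣ a - b

  open _≡_mod_ public

  ≡-mod-intro : + m Signed.∣ a - b → a ≡ b mod m
  ≡-mod-intro = mk≡mod ∘ ∣⇒∣ᵤ

  ≡-mod-elim : a ≡ b mod m → + m Signed.∣ a - b
  ≡-mod-elim {a} {b} {m} a≡b = ∣ᵤ⇒∣ {+ m} {a - b} (m∣a-b a≡b)

  ≡-mod-offset : ∀ q → a ≡ b + q * + m → a ≡ b mod m
  ≡-mod-offset {b = b} {m} q refl = ≡-mod-intro (divides q (b+x-b≡x b (q * + m)))
    where
    b+x-b≡x : ∀ b x → b + x - b ≡ x
    b+x-b≡x = solve-∀

  ≡-mod-refl : a ≡ a mod m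
  ≡-mod-refl {a} = ≡-mod-offset 0ℤ (sym (+-identityʳ a))

  ≡-mod-reflexive : a ≡ b → a ≡ b mod m
  ≡-mod-reflexive refl = ≡-mod-refl

  ≡-mod-sym : a ≡ b mod m → b ≡ a mod m
  ≡-mod-sym {a} {b} {m} (mk≡mod m∣a-b) = mk≡mod (subst (m ℕ.∣_) (∣i-j∣≡∣j-i∣ a b) m∣a-b)

  ≡-mod-trans : a ≡ b mod m → b ≡ c mod m → a ≡ c mod m
  ≡-mod-trans {a} {b} {c = c} a≡b b≡c =
    ≡-mod-intro (subst (_ Signed.∣_) (telescope a b c) (Signed.∣m∣n⇒∣m+n (≡-mod-elim a≡b) (≡-mod-elim b≡c)))
    where
    telescope : ∀ a b c → (a - b) + (b - c) ≡ a - c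
    telescope = solve-∀

  ≡-mod-isEquivalence : IsEquivalence (_≡_mod m)
  ≡-mod-isEquivalence = record { refl = ≡-mod-refl ; sym = ≡-mod-sym ; trans = ≡-mod-trans }

  ≡-mod-setoid : ℕ → Setoid 0ℓ 0ℓ
  ≡-mod-setoid m = record { isEquivalence = ≡-mod-isEquivalence {m} }

  module ≡-mod-Reasoning (m : ℕ) where
    open import Relation.Binary.Reasoning.Setoid (≡-mod-setoid m) public

  +-cong-mod : a ≡ b mod m → c ≡ d mod m → a + c ≡ b + d mod m
  +-cong-mod {a} {b} {c = c} {d} a≡b c≡d =
    ≡-mod-intro (subst (_ Signed.∣_) (regroup a b c d) (Signed.∣m∣n⇒∣m+n (≡-mod-elim a≡b) (≡-mod-elim c≡d)))
    where
    regroup : ∀ a b c d → (a - b) + (c - d) ≡ (a + c) - (b + d)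
    regroup = solve-∀

  *-cong-mod : a ≡ b mod m → c ≡ d mod m → a * c ≡ b * d mod m
  *-cong-mod {a} {b} {c = c} {d} a≡b c≡d =
    ≡-mod-intro (subst (_ Signed.∣_) (regroup a b c d)
      (Signed.∣m∣n⇒∣m+n (Signed.∣m⇒∣m*n c (≡-mod-elim a≡b)) (Signed.∣n⇒∣m*n b (≡-mod-elim c≡d))))
    where
    regroup : ∀ a b c d → (a - b) * c + b * (c - d) ≡ a * c - b * d
    regroup = solve-∀

  +-congˡ-mod : ∀ c → a ≡ b mod m → c + a ≡ c + b mod m
  +-congˡ-mod c = +-cong-mod (≡-mod-refl {c})

  +-congʳ-mod : ∀ c → a ≡ b mod m → a + c ≡ b + c mod m
  +-congʳ-mod c a≡b = +-cong-mod a≡b (≡-mod-refl {c})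

  *-congˡ-mod : ∀ c → a ≡ b mod m → c * a ≡ c * b mod m
  *-congˡ-mod c = *-cong-mod (≡-mod-refl {c})

  ^-cong-mod : ∀ k → a ≡ b mod m → a ^ k ≡ b ^ k mod m
  ^-cong-mod zero    a≡b = ≡-mod-refl
  ^-cong-mod (suc k) a≡b = *-cong-mod a≡b (^-cong-mod k a≡b)

  %ℕ-≡-mod : ∀ a m .{{_ : NonZero m}} → + (a %ℕ m) ≡ a mod m
  %ℕ-≡-mod a m = ≡-mod-sym (≡-mod-offset (a /ℕ m) (a≡a%ℕn+[a/ℕn]*n a m))

  ≡-mod? : ∀ a b m → Dec (a ≡ b mod m)
  ≡-mod? a b m = Dec.map′ mk≡mod m∣a-b (m ℕ.∣? ∣ a - b ∣)

  kth-root-mod? : ∀ k m .{{_ : NonZero m}} a → Dec (∃[ x ] + m ∣ x ^ k - a)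
  kth-root-mod? k m a =
    Dec.map′ (λ (i , _ , iᵏ≡a) → + i , m∣a-b iᵏ≡a) reduce (ℕ.anyUpTo? (λ i → ≡-mod? ((+ i) ^ k) a m) m)
    where
    reduce : ∃[ x ] + m ∣ x ^ k - a → ∃[ i ] i ℕ.< m × (+ i) ^ k ≡ a mod m
    reduce (x , m∣xᵏ-a) = x %ℕ m , n%ℕd<d x m , ≡-mod-trans (^-cong-mod k (%ℕ-≡-mod x m)) (mk≡mod m∣xᵏ-a)

  shift-into-window : ∀ c n m .{{_ : NonZero n}} .{{_ : NonZero m}} →
                      ∃₂ λ q j → q ℕ.* n ℕ.< m × j ℕ.< n × c + + (q ℕ.* n) ≡ + j mod m
  shift-into-window c n@(suc n-1) m = q , n-1 ∸ s , qn<m , s≤s (ℕ.m∸n≤m n-1 s) , c+qn≡n-1-s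
    where
    open ≡-mod-Reasoning m
    -- e ≡ n − 1 − c, and e = s + q n with s < n, so c + q n ≡ n − 1 − s.
    e q s : ℕ
    e = (+ n-1 - c) %ℕ m
    q = e ℕ./ n
    s = e ℕ.% n
    e≡s+qn : e ≡ s ℕ.+ q ℕ.* n
    e≡s+qn = ℕ.m≡m%n+[m/n]*n e n
    qn<m : q ℕ.* n ℕ.< m
    qn<m = ℕ.≤-<-trans (ℕ.m≤n+m _ s) (subst (ℕ._< m) e≡s+qn (n%ℕd<d (+ n-1 - c) m))
    qn≡e-s : + (q ℕ.* n) ≡ + e - + s
    qn≡e-s = trans (cong +_ (sym (trans (cong (_∸ s) e≡s+qn) (ℕ.m+n∸m≡n s _)))) (pos-∸ (ℕ.m%n≤m e n))
    cancel : ∀ c x y → c + ((x - c) - y) ≡ x - y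
    cancel = solve-∀
    c+qn≡n-1-s : c + + (q ℕ.* n) ≡ + (n-1 ∸ s) mod m
    c+qn≡n-1-s = begin
      c + + (q ℕ.* n)          ≡⟨ cong (λ x → c + x) qn≡e-s ⟩
      c + (+ e - + s)          ≈⟨ +-congˡ-mod c (+-congʳ-mod (- + s) (%ℕ-≡-mod (+ n-1 - c) m)) ⟩
      c + ((+ n-1 - c) - + s)  ≡⟨ cancel c (+ n-1) (+ s) ⟩
      + n-1 - + s              ≡⟨ pos-∸ (ℕ.≤-pred (ℕ.m%n<n e n)) ⟨
      + (n-1 ∸ s)              ∎

  coprime-* : ∀ a b → Coprime ∣ a ∣ m → Coprime ∣ b ∣ m → Coprime ∣ a * b ∣ m
  coprime-* {m} a b a⊥m b⊥m (d∣ab , d∣m) =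
    b⊥m (coprime-divisor d⊥a (subst (_ ℕ.∣_) (abs-* a b) d∣ab) , d∣m)
    where
    d⊥a : Coprime _ ∣ a ∣
    d⊥a (e∣d , e∣a) = a⊥m (e∣a , ℕ.∣-trans e∣d d∣m)

  coprime-factorˡ : ∀ a b → Coprime ∣ a * b ∣ m → Coprime ∣ a ∣ m
  coprime-factorˡ a b ab⊥m (d∣a , d∣m) =
    ab⊥m (subst (_ ℕ.∣_) (sym (abs-* a b)) (ℕ.∣m⇒∣m*n ∣ b ∣ d∣a) , d∣m)

  coprime-factorʳ : ∀ a b → Coprime ∣ a * b ∣ m → Coprime ∣ b ∣ m
  coprime-factorʳ a b ab⊥m (d∣b , d∣m) =
    ab⊥m (subst (_ ℕ.∣_) (sym (abs-* a b)) (ℕ.∣n⇒∣m*n ∣ a ∣ d∣b) , d∣m)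

  coprime-respects-≡-mod : a ≡ b mod m → Coprime ∣ a ∣ m → Coprime ∣ b ∣ m
  coprime-respects-≡-mod {a} {b} {m} a≡b a⊥m {d} (d∣b , d∣m) = a⊥m (∣⇒∣ᵤ d∣a , d∣m)
    where
    b+[a-b]≡a : ∀ a b → b + (a - b) ≡ a
    b+[a-b]≡a = solve-∀
    d∣a : + d Signed.∣ a
    d∣a = subst (_ Signed.∣_) (b+[a-b]≡a a b)
      (Signed.∣m∣n⇒∣m+n (∣ᵤ⇒∣ {+ d} {b} d∣b) (Signed.∣-trans (∣ᵤ⇒∣ {+ d} {+ m} d∣m) (≡-mod-elim a≡b)))

  coprime⇒invertible⁺ : Coprime i m → ∃[ u ] u * + i ≡ 1ℤ mod m
  coprime⇒invertible⁺ {i} {m} i⊥m with coprime-Bézout i⊥m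
  ... | Bézout.+- x y 1+ym≡xi = + x , ≡-mod-offset (+ y) (begin
    + x * + i          ≡⟨ pos-* x i ⟨
    + (x ℕ.* i)        ≡⟨ cong +_ 1+ym≡xi ⟨
    1ℤ + + (y ℕ.* m)   ≡⟨ cong (λ z → 1ℤ + z) (pos-* y m) ⟩
    1ℤ + + y * + m     ∎)
    where open ≡-Reasoning
  ... | Bézout.-+ x y 1+xi≡ym = - + x , ≡-mod-offset (- + y) (begin
    - + x * + i             ≡⟨ negate (+ x) (+ i) ⟩
    1ℤ - (1ℤ + + x * + i)   ≡⟨ cong (λ z → 1ℤ - (1ℤ + z)) (pos-* x i) ⟨
    1ℤ - + (1 ℕ.+ x ℕ.* i)  ≡⟨ cong (λ z → 1ℤ - + z) 1+xi≡ym ⟩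
    1ℤ - + (y ℕ.* m)        ≡⟨ cong (λ z → 1ℤ - z) (pos-* y m) ⟩
    1ℤ - + y * + m          ≡⟨ cong (λ z → 1ℤ + z) (neg-distribˡ-* (+ y) (+ m)) ⟩
    1ℤ + - + y * + m        ∎)
    where
    open ≡-Reasoning
    negate : ∀ x i → - x * i ≡ 1ℤ - (1ℤ + x * i)
    negate = solve-∀

  coprime⇒invertible : ∀ a → Coprime ∣ a ∣ m → ∃[ u ] u * a ≡ 1ℤ mod m
  coprime⇒invertible (+ n)    n⊥m = coprime⇒invertible⁺ n⊥m
  coprime⇒invertible -[1+ n ] n⊥m with coprime⇒invertible⁺ n⊥m
  ... | u , u*n≡1 = - u , ≡-mod-trans (≡-mod-reflexive (neg*neg u (+ suc n))) u*n≡1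
    where
    neg*neg : ∀ u x → - u * - x ≡ u * x
    neg*neg = solve-∀

-- IsPowerResidue and its relatives unfold too far for k, m or the residue itself to be inferred,
-- so k and m are module parameters and residues are passed explicitly where needed.
module PowerResidues (k m : ℕ) where

  open ModularArithmetic
  open import Data.Nat as ℕ using (zero; suc; _∸_; z≤n; s≤s; NonZero)
  import Data.Nat.Properties as ℕ
  import Data.Nat.DivMod as ℕ
  open import Data.Nat.Coprimality as Coprime using (Coprime; prime⇒coprime)
  open import Data.Nat.Primality using (Prime; prime⇒nonZero)
  open import Data.Integer using (ℤ; +_; ∣_∣; _+_; _-_; -_; _*_; _^_; 0ℤ; 1ℤ; -1ℤ)
  open import Data.Integer.Properties using (pos-*; -1*i≡-i; ^-zeroˡ; *-identityʳ)
  open import Data.Integer.Tactic.RingSolver using (solve-∀)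
  open import Data.Product using (∃₂; ∃-syntax; _×_; _,_; proj₁; proj₂)
  open import Data.Sum using (inj₁; inj₂)
  open import Relation.Binary.PropositionalEquality using (_≡_; refl; sym; trans; cong; subst)
  open import Relation.Nullary using (¬_)
  open import Relation.Nullary.Decidable using (decidable-stable)

  private variable
    a b : ℤ
    i j n R : ℕ

  nonresidue⇒¬residue : ∀ a → IsPowerNonResidue k m a → ¬ IsPowerResidue k m a
  nonresidue⇒¬residue _ (_ , no-root) (_ , root) = no-root root

  residue-respects-≡-mod : a ≡ b mod m → IsPowerResidue k m a → IsPowerResidue k m b
  residue-respects-≡-mod {a} a≡b (a⊥m , x , m∣xᵏ-a) =
    coprime-respects-≡-mod a≡b a⊥m , x , m∣a-b (≡-mod-trans (mk≡mod {x ^ k} {a} m∣xᵏ-a) a≡b)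

  residue-* : ∀ a b → IsPowerResidue k m a → IsPowerResidue k m b → IsPowerResidue k m (a * b)
  residue-* a b (a⊥m , x , m∣xᵏ-a) (b⊥m , y , m∣yᵏ-b) =
    coprime-* a b a⊥m b⊥m , x * y ,
    m∣a-b (≡-mod-trans (≡-mod-reflexive (^-distrib-* x y k))
                       (*-cong-mod (mk≡mod {x ^ k} {a} m∣xᵏ-a) (mk≡mod {y ^ k} {b} m∣yᵏ-b)))

  residue-cancelʳ : .{{_ : NonZero k}} → ∀ a b → IsPowerResidue k m (a * b) → IsPowerResidue k m b →
                    IsPowerResidue k m a
  residue-cancelʳ a b (ab⊥m , z , m∣zᵏ-ab) (b⊥m , x , m∣xᵏ-b) =
    coprime-factorˡ a b ab⊥m , w * z , m∣a-b [wz]ᵏ≡a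
    where
    open ≡-mod-Reasoning m
    inverse : ∃[ u ] u * b ≡ 1ℤ mod m
    inverse = coprime⇒invertible b b⊥m
    u w : ℤ
    u = proj₁ inverse
    w = u * x ^ (k ∸ 1)
    rotate : ∀ u y x → u * y * x ≡ u * (x * y)
    rotate = solve-∀
    swap : ∀ c a d → c * (a * d) ≡ a * (c * d)
    swap = solve-∀
    zᵏ≡ab : z ^ k ≡ a * b mod m
    zᵏ≡ab = mk≡mod m∣zᵏ-ab
    xᵏ≡b : x ^ k ≡ b mod m
    xᵏ≡b = mk≡mod m∣xᵏ-b
    wx≡1 : w * x ≡ 1ℤ mod m
    wx≡1 = begin
      u * x ^ (k ∸ 1) * x    ≡⟨ rotate u (x ^ (k ∸ 1)) x ⟩
      u * (x * x ^ (k ∸ 1))  ≡⟨ cong (u *_) (i*i^[k∸1]≡i^k k x) ⟩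
      u * x ^ k              ≈⟨ *-congˡ-mod u xᵏ≡b ⟩
      u * b                  ≈⟨ proj₂ inverse ⟩
      1ℤ                     ∎
    [wz]ᵏ≡a : (w * z) ^ k ≡ a mod m
    [wz]ᵏ≡a = begin
      (w * z) ^ k          ≡⟨ ^-distrib-* w z k ⟩
      w ^ k * z ^ k        ≈⟨ *-congˡ-mod (w ^ k) zᵏ≡ab ⟩
      w ^ k * (a * b)      ≈⟨ *-congˡ-mod (w ^ k) (*-congˡ-mod a (≡-mod-sym xᵏ≡b)) ⟩
      w ^ k * (a * x ^ k)  ≡⟨ swap (w ^ k) a (x ^ k) ⟩
      a * (w ^ k * x ^ k)  ≡⟨ cong (a *_) (^-distrib-* w x k) ⟨
      a * (w * x) ^ k      ≈⟨ *-congˡ-mod a (^-cong-mod k wx≡1) ⟩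
      a * 1ℤ ^ k           ≡⟨ cong (a *_) (^-zeroˡ k) ⟩
      a * 1ℤ               ≡⟨ *-identityʳ a ⟩
      a                    ∎

  -- Residuosity is decidable, which turns the negative minimality clause of IsLeastNonResidue
  -- into positive information.
  ¬nonresidue⇒residue : .{{_ : NonZero m}} → ∀ a → Coprime ∣ a ∣ m → ¬ IsPowerNonResidue k m a →
                        IsPowerResidue k m a
  ¬nonresidue⇒residue a a⊥m ¬nonres =
    a⊥m , decidable-stable (kth-root-mod? k m a) (λ no-root → ¬nonres (a⊥m , no-root))

  1-not-nonresidue : ¬ IsPowerNonResidue k m 1ℤ
  1-not-nonresidue (_ , no-root) = no-root (1ℤ , m∣a-b (≡-mod-reflexive {1ℤ ^ k} {1ℤ} {m} (^-zeroˡ k)))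

  -- j = 0 is coprime to m only when m = 1; then 0 ≡ 0 ^ k.
  below-least-nonresidue : .{{_ : NonZero k}} .{{_ : NonZero m}} → IsLeastNonResidue k m n → j ℕ.< n →
                           Coprime j m → IsPowerResidue k m (+ j)
  below-least-nonresidue {j = zero} _ _ 0⊥m =
    0⊥m , 0ℤ , m∣a-b (≡-mod-reflexive {0ℤ ^ k} {0ℤ} {m} (sym (i*i^[k∸1]≡i^k k 0ℤ)))
  below-least-nonresidue {j = suc j} (_ , _ , minimal) j<n j⊥m =
    ¬nonresidue⇒residue (+ suc j) j⊥m (minimal (suc j) (s≤s z≤n) j<n)

  least-nonresidue<modulus : .{{_ : NonZero k}} .{{_ : NonZero m}} → IsLeastNonResidue k m n → n ℕ.< m
  least-nonresidue<modulus {n} least@(_ , nonres , _) = ℕ.≰⇒> λ m≤n →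
    nonresidue⇒¬residue (+ n) nonres (residue-respects-≡-mod n%m≡n
      (below-least-nonresidue least (ℕ.<-≤-trans (ℕ.m%n<n n m) m≤n)
        (coprime-respects-≡-mod (≡-mod-sym n%m≡n) (proj₁ nonres))))
    where
    n%m≡n : + (n ℕ.% m) ≡ + n mod m
    n%m≡n = %ℕ-≡-mod (+ n) m

  below-least-nonresidue-prime : .{{_ : NonZero k}} → Prime m → IsLeastNonResidue k m n →
                                 1 ℕ.≤ j → j ℕ.< n → IsPowerResidue k m (+ j)
  below-least-nonresidue-prime m-prime least (s≤s z≤n) j<n =
    below-least-nonresidue least j<n
      (Coprime.sym (prime⇒coprime m-prime (ℕ.<-trans j<n (least-nonresidue<modulus least))))
    where instance _ = prime⇒nonZero m-prime

  residue-run-bound : .{{_ : NonZero k}} .{{_ : NonZero m}} → ∀ a → IsLeastNonResidue k m n →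
                      IsResidueRun k m a R → R ℕ.* n ℕ.< m
  residue-run-bound {n} {R} a least@(s≤s z≤n , nonres , _) run =
    ℕ.≰⇒> λ m≤Rn → window-contradiction m≤Rn (shift-into-window (+ n * (a + 1ℤ)) n m)
    where
    expand : ∀ n a q → n * (a + (1ℤ + q)) ≡ n * (a + 1ℤ) + q * n
    expand = solve-∀
    window-contradiction : m ℕ.≤ R ℕ.* n →
      ¬ ∃₂ λ q j → q ℕ.* n ℕ.< m × j ℕ.< n × + n * (a + 1ℤ) + + (q ℕ.* n) ≡ + j mod m
    window-contradiction m≤Rn (q , j , qn<m , j<n , n[a+1]+qn≡j) =
      nonresidue⇒¬residue (+ n) nonres (residue-cancelʳ (+ n) y ny-residue y-residue)
      where
      y : ℤ
      y = a + + suc q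
      y-residue : IsPowerResidue k m y
      y-residue = run (suc q) (s≤s z≤n) (ℕ.*-cancelʳ-< n q R (ℕ.<-≤-trans qn<m m≤Rn))
      ny≡j : + n * y ≡ + j mod m
      ny≡j = ≡-mod-trans
        (≡-mod-reflexive (trans (expand (+ n) a (+ q)) (cong (λ x → + n * (a + 1ℤ) + x) (sym (pos-* q n)))))
        n[a+1]+qn≡j
      ny-residue : IsPowerResidue k m (+ n * y)
      ny-residue = residue-respects-≡-mod (≡-mod-sym ny≡j) (below-least-nonresidue least j<n
        (coprime-respects-≡-mod ny≡j (coprime-* (+ n) y (proj₁ nonres) (proj₁ y-residue))))

  least-nonresidue≤cofactor : .{{_ : NonZero k}} .{{_ : NonZero m}} → ∀ j → IsLeastNonResidue k m n →
                              i ℕ.< n → IsPowerResidue k m (+ n * (+ j * + i)) → n ℕ.≤ j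
  least-nonresidue≤cofactor {n} {i} j least@(_ , nonres , _) i<n nji-residue = ℕ.≮⇒≥ λ j<n →
    nonresidue⇒¬residue (+ n) nonres (residue-cancelʳ (+ n) (+ j * + i) nji-residue
      (residue-* (+ j) (+ i) (below-least-nonresidue least j<n j⊥m) (below-least-nonresidue least i<n i⊥m)))
    where
    ji⊥m : Coprime ∣ + j * + i ∣ m
    ji⊥m = coprime-factorʳ (+ n) (+ j * + i) (proj₁ nji-residue)
    j⊥m : Coprime j m
    j⊥m = coprime-factorˡ (+ j) (+ i) ji⊥m
    i⊥m : Coprime i m
    i⊥m = coprime-factorʳ (+ j) (+ i) ji⊥m

  least-nonresidue≤half : .{{_ : NonZero k}} .{{_ : NonZero m}} → ∀ t → IsLeastNonResidue k m n → 2 ℕ.< n →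
                          IsPowerResidue k m (+ n * + (t ℕ.* 2)) → n ℕ.≤ t
  least-nonresidue≤half {n} t least 2<n n2t-residue =
    least-nonresidue≤cofactor t least 2<n (subst (λ x → IsPowerResidue k m (+ n * x)) (pos-* t 2) n2t-residue)

  least-nonresidue*2≤suc : .{{_ : NonZero k}} .{{_ : NonZero m}} → ∀ q → IsLeastNonResidue k m n → 2 ℕ.< n →
                           IsPowerResidue k m (+ n * + q) × IsPowerResidue k m (+ n * + suc q) →
                           n ℕ.* 2 ℕ.≤ suc q
  least-nonresidue*2≤suc {n} q least 2<n (nq-residue , nq+n-residue) with even-or-odd q
  ... | t , inj₁ refl =
    ℕ.≤-trans (ℕ.*-monoˡ-≤ 2 (least-nonresidue≤half t least 2<n nq-residue)) (ℕ.n≤1+n q)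
  ... | t , inj₂ t*2≡q+1 = subst (n ℕ.* 2 ℕ.≤_) t*2≡q+1 (ℕ.*-monoˡ-≤ 2 (least-nonresidue≤half t least 2<n
    (subst (λ y → IsPowerResidue k m (+ n * + y)) (sym t*2≡q+1) nq+n-residue)))

  quotient-multiples-residue : .{{_ : NonZero k}} → ∀ {q r} → Prime m → IsPowerResidue k m -1ℤ →
                               IsLeastNonResidue k m n → m ≡ r ℕ.+ q ℕ.* n → 1 ℕ.≤ r → r ℕ.< n →
                               IsPowerResidue k m (+ n * + q) × IsPowerResidue k m (+ n * + suc q)
  quotient-multiples-residue {n} {q} {r} m-prime -1-residue least m≡r+qn 1≤r r<n =
    residue-respects-≡-mod (≡-mod-sym nq≡-r) -r-residue ,
    residue-respects-≡-mod (≡-mod-sym n[q+1]≡n-r) n-r-residue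
    where
    m≡r+qn′ : + m ≡ + r + + q * + n
    m≡r+qn′ = trans (cong +_ m≡r+qn) (cong (λ x → + r + x) (pos-* q n))
    negate : ∀ n q r → n * q ≡ - r + 1ℤ * (r + q * n)
    negate = solve-∀
    shift : ∀ n q r → n * (1ℤ + q) ≡ (n - r) + 1ℤ * (r + q * n)
    shift = solve-∀
    nq≡-r : + n * + q ≡ - + r mod m
    nq≡-r = ≡-mod-offset 1ℤ (trans (negate (+ n) (+ q) (+ r)) (cong (λ x → - + r + 1ℤ * x) (sym m≡r+qn′)))
    n[q+1]≡n-r : + n * + suc q ≡ + n - + r mod m
    n[q+1]≡n-r =
      ≡-mod-offset 1ℤ (trans (shift (+ n) (+ q) (+ r)) (cong (λ x → (+ n - + r) + 1ℤ * x) (sym m≡r+qn′)))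
    -r-residue : IsPowerResidue k m (- + r)
    -r-residue = residue-respects-≡-mod (≡-mod-reflexive (-1*i≡-i (+ r)))
      (residue-* -1ℤ (+ r) -1-residue (below-least-nonresidue-prime m-prime least 1≤r r<n))
    n-r-residue : IsPowerResidue k m (+ n - + r)
    n-r-residue = subst (IsPowerResidue k m) (pos-∸ (ℕ.<⇒≤ r<n))
      (below-least-nonresidue-prime m-prime least (ℕ.m<n⇒0<n∸m r<n) (ℕ.∸-monoʳ-< 1≤r (ℕ.<⇒≤ r<n)))

open import Data.Nat using (zero; suc; _+_; _*_; _∸_; _^_; _≤_; _<_; _>_; z≤n; s≤s; s≤s⁻¹; NonZero)
open import Data.Nat.Properties
  using ( *-suc; *-identityʳ; *-monoʳ-≤; *-monoʳ-<; *-monoˡ-≤; +-mono-≤; ≤-trans; m≤m+n; m<m+n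
        ; n≢0⇒n>0; module ≤-Reasoning)
open import Data.Nat.DivMod using (_%_; _/_; m≡m%n+[m/n]*n; m%n<n)
open import Data.Nat.Divisibility using (∣-refl; m%n≡0⇒n∣m)
open import Data.Nat.GCD using (gcd)
open import Data.Nat.Primality using (Prime; prime⇒nonZero)
open import Data.Nat.Tactic.RingSolver using (solve-∀)
open import Data.Integer using (0ℤ; -1ℤ)
open import Data.Product using (_×_; _,_; proj₁; proj₂)
open import Relation.Binary.PropositionalEquality using (_≡_; _≢_; refl; sym; cong; subst)
open import Relation.Nullary using (contradiction)

[n∸1]n<m⇒[2n∸1]²<4m : ∀ n {m} → (n ∸ 1) * n < m → (2 * n ∸ 1) ^ 2 < 4 * m
[n∸1]n<m⇒[2n∸1]²<4m zero 0<m = *-monoʳ-< 4 0<m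
[n∸1]n<m⇒[2n∸1]²<4m (suc n) {m} n[n+1]<m = begin-strict
  (2 * suc n ∸ 1) ^ 2            ≡⟨ cong (λ x → (x ∸ 1) ^ 2) (*-suc 2 n) ⟩
  (1 + 2 * n) ^ 2                ≡⟨ cong ((1 + 2 * n) *_) (*-identityʳ (1 + 2 * n)) ⟩
  (1 + 2 * n) * (1 + 2 * n)      <⟨ m<m+n _ (s≤s z≤n) ⟩
  (1 + 2 * n) * (1 + 2 * n) + 3  ≡⟨ expand n ⟩
  4 * (1 + n * suc n)            ≤⟨ *-monoʳ-≤ 4 n[n+1]<m ⟩
  4 * m                          ∎
  where
  open ≤-Reasoning
  expand : ∀ n → (1 + 2 * n) * (1 + 2 * n) + 3 ≡ 4 * (1 + n * (1 + n))
  expand = solve-∀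

2n≤q+1⇒[4n∸1]²<8[r+qn] : ∀ n {q r} → 1 ≤ r → n * 2 ≤ suc q → (4 * n ∸ 1) ^ 2 < 8 * (r + q * n)
2n≤q+1⇒[4n∸1]²<8[r+qn] zero {q} {r} 1≤r _ = *-monoʳ-< 8 (≤-trans 1≤r (m≤m+n r (q * 0)))
2n≤q+1⇒[4n∸1]²<8[r+qn] (suc n) {q} {r} 1≤r 2[n+1]≤q+1 = begin-strict
  (4 * suc n ∸ 1) ^ 2            ≡⟨ cong (λ x → (x ∸ 1) ^ 2) (*-suc 4 n) ⟩
  (3 + 4 * n) ^ 2                ≡⟨ cong ((3 + 4 * n) *_) (*-identityʳ (3 + 4 * n)) ⟩
  (3 + 4 * n) * (3 + 4 * n)      <⟨ m<m+n _ (s≤s z≤n) ⟩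
  (3 + 4 * n) * (3 + 4 * n) + 7  ≡⟨ expand n ⟩
  8 * (1 + (1 + n * 2) * suc n)  ≤⟨ *-monoʳ-≤ 8 (+-mono-≤ 1≤r (*-monoˡ-≤ (suc n) (s≤s⁻¹ 2[n+1]≤q+1))) ⟩
  8 * (r + q * suc n)            ∎
  where
  open ≤-Reasoning
  expand : ∀ n → (3 + 4 * n) * (3 + 4 * n) + 7 ≡ 8 * (1 + (1 + n * 2) * (1 + n))
  expand = solve-∀

prime-least-nonresidue-bound : ∀ k {m n} .{{_ : NonZero k}} → Prime m → IsLeastNonResidue k m n →
                               (2 * n ∸ 1) ^ 2 < 4 * m
prime-least-nonresidue-bound k {n = zero}  _       (() , _)
prime-least-nonresidue-bound k {m} {suc n} m-prime least =
  [n∸1]n<m⇒[2n∸1]²<4m (suc n) (residue-run-bound 0ℤ least initial-run)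
  where
  open PowerResidues k m
  instance _ = prime⇒nonZero m-prime
  initial-run : IsResidueRun k m 0ℤ n
  initial-run i 1≤i i≤n = below-least-nonresidue-prime m-prime least 1≤i (s≤s i≤n)

-1-residue⇒least-nonresidue-bound : ∀ k {p n} .{{_ : NonZero k}} → Prime p → IsPowerResidue k p -1ℤ →
                                    IsLeastNonResidue k p n → n ≢ 2 → (4 * n ∸ 1) ^ 2 < 8 * p
-1-residue⇒least-nonresidue-bound k {n = 0} _ _ (() , _) _
-1-residue⇒least-nonresidue-bound k {p} {1} _ _ (_ , nonres , _) _ =
  contradiction nonres (PowerResidues.1-not-nonresidue k p)
-1-residue⇒least-nonresidue-bound k {n = 2} _ _ _ n≢2 = contradiction refl n≢2
-1-residue⇒least-nonresidue-bound k {p} {n@(suc (suc (suc _)))} p-prime -1-residue least@(_ , nonres , _) _ =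
  subst (λ x → (4 * n ∸ 1) ^ 2 < 8 * x) (sym p≡r+qn)
    (2n≤q+1⇒[4n∸1]²<8[r+qn] n 1≤r (least-nonresidue*2≤suc q least 2<n
      (quotient-multiples-residue p-prime -1-residue least p≡r+qn 1≤r (m%n<n p n))))
  where
  open PowerResidues k p
  instance _ = prime⇒nonZero p-prime
  2<n : 2 < n
  2<n = s≤s (s≤s (s≤s z≤n))
  r q : ℕ
  r = p % n
  q = p / n
  p≡r+qn : p ≡ r + q * n
  p≡r+qn = m≡m%n+[m/n]*n p n
  1≤r : 1 ≤ r
  1≤r = n≢0⇒n>0 (λ r≡0 → contradiction (proj₁ nonres (∣-refl , m%n≡0⇒n∣m p n r≡0)) λ ())

theorem1 : (∀ (m k n : ℕ) → 1 ≤ m → 1 ≤ k → IsLeastNonResidue k m n →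
    (∀ (R : ℕ) → IsGreatestResidueRun k m R → R * n < m)
    × (Prime m → (2 * n ∸ 1) ^ 2 < 4 * m))
    × (∀ (p k n : ℕ) → Prime p → p ≢ 2 → 1 ≤ k → gcd k (p ∸ 1) > 1 →
    IsPowerResidue k p -1ℤ → IsLeastNonResidue k p n → n ≢ 2 →
    (4 * n ∸ 1) ^ 2 < 8 * p)
proj₁ theorem1 (suc m) (suc k) n _ _ least =
  (λ R ((a , run) , _) → PowerResidues.residue-run-bound (suc k) (suc m) a least run) ,
  λ m-prime → prime-least-nonresidue-bound (suc k) m-prime least
-- p ≢ 2 and gcd k (p ∸ 1) > 1 only guarantee that a non-residue exists, which least already provides.
proj₂ theorem1 p (suc k) n p-prime _ _ _ -1-residue least n≢2 =
  -1-residue⇒least-nonresidue-bound (suc k) p-prime -1-residue least n≢2
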